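{- Let $G$ be a connected graph with $\gamma(G)=1$ and let $r\ge 1$. Then the join of $r$ disjoint copies of $G$, $G\vee G\vee\cdots\vee G$ ($r$ copies), satisfies $\zeta(G\vee\cdots\vee G)=r\,\zeta(G)$.
   Context: All graphs are finite and simple. For a graph $G=(V,E)$, a set $S\subseteq V$ is a dominating set if every vertex of $V\setminus S$ is adjacent to some vertex of $S$. The domination number $\gamma(G)$ is the minimum cardinality of a dominating set; a dominating set of cardinality $\gamma(G)$ is called a $\gamma$-set. The dominion $\zeta(G)$ is the number of $\gamma$-sets of $G$. The join $G_1\vee G_2$ is the graph obtained from the disjoint union of $G_1$ and $G_2$ by adding all edges between $V(G_1)$ and $V(G_2)$; the join of several graphs is formed iteratively (for $r=1$ it is $G$ itself). -}

module Defs where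

open import Data.Nat using (ℕ; zero; suc; _*_; _≤_; _⊓_)
open import Data.Bool using (Bool; true; false; _∧_; _∨_; if_then_else_)
open import Data.Fin using (Fin; _≟_; remQuot)
open import Data.Fin.Subset using (Subset; ∣_∣; _∈_; inside; outside)
open import Data.Vec using (Vec; []; _∷_; lookup)
open import Data.List using (List; []; _∷_; map; _++_; filter; length; foldr)
open import Data.List.Relation.Unary.Any using (Any)
open import Data.List.Relation.Unary.All using (All)
open import Data.Product using (_×_; _,_; proj₁; proj₂; ∃)
open import Data.Empty using (⊥-elim)
open import Relation.Nullary using (yes; no)
open import Relation.Nullary.Decidable using (does; ⌊_⌋)
open import Relation.Binary.PropositionalEquality using (_≡_; refl)
open import Relation.Unary using (Decidable)
open import Function using (_∘_)

record Graph (n : ℕ) : Set where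
  field
    adj    : Fin n → Fin n → Bool
    sym    : ∀ u v → adj u v ≡ adj v u
    irrefl : ∀ v → adj v v ≡ false
open Graph public

data Reach {n : ℕ} (G : Graph n) : Fin n → Fin n → Set where
  here : ∀ {v} → Reach G v v
  step : ∀ {u w v} → adj G u w ≡ true → Reach G w v → Reach G u v

Connected : ∀ {n} → Graph n → Set
Connected G = ∀ u v → Reach G u v

mem : ∀ {n} → Fin n → Subset n → Bool
mem i S with lookup S i
... | inside  = true
... | outside = false

anyFin : ∀ {n} → (Fin n → Bool) → Bool
anyFin {zero}  f = false
anyFin {suc n} f = f Fin.zero ∨ anyFin (f ∘ Fin.suc)
  where import Data.Fin as Fin

allFin : ∀ {n} → (Fin n → Bool) → Bool
allFin {zero}  f = true
allFin {suc n} f = f Fin.zero ∧ allFin (f ∘ Fin.suc)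
  where import Data.Fin as Fin

isDominating : ∀ {n} → Graph n → Subset n → Bool
isDominating G S =
  allFin (λ v → mem v S ∨ anyFin (λ u → mem u S ∧ adj G u v))

allSubsets : ∀ n → List (Subset n)
allSubsets zero    = [] ∷ []
allSubsets (suc n) = map (inside ∷_) (allSubsets n) ++ map (outside ∷_) (allSubsets n)

dominatingSets : ∀ {n} → Graph n → List (Subset n)
dominatingSets {n} G = filter (λ S → isDominating G S Data.Bool.≟ true) (allSubsets n)
  where import Data.Bool

-- domination number: minimum cardinality of a dominating set
-- (V itself is always dominating, so n is a valid upper bound to start from)
γ : ∀ {n} → Graph n → ℕ
γ {n} G = foldr (λ S m → ∣ S ∣ ⊓ m) n (dominatingSets G)

ζ : ∀ {n} → Graph n → ℕ
ζ G = length (filter (λ S → ∣ S ∣ Data.Nat.≟ γ G) (dominatingSets G))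
  where import Data.Nat

-- Join of r disjoint copies of G; vertex set Fin (r * n), vertex k ↔ (copy i, vertex a)
-- via remQuot.
jadj : ∀ {n r} → Graph n → Fin r × Fin n → Fin r × Fin n → Bool
jadj G (i , a) (j , b) = if ⌊ i ≟ j ⌋ then adj G a b else true

jadj-sym : ∀ {n r} (G : Graph n) (p q : Fin r × Fin n) → jadj G p q ≡ jadj G q p
jadj-sym G (i , a) (j , b) with i ≟ j | j ≟ i
... | yes refl | yes _ = Graph.sym G a b
... | yes refl | no ¬p = ⊥-elim (¬p refl)
... | no ¬p | yes refl = ⊥-elim (¬p refl)
... | no _ | no _ = refl

jadj-irrefl : ∀ {n r} (G : Graph n) (p : Fin r × Fin n) → jadj G p p ≡ false
jadj-irrefl G (i , a) with i ≟ i
... | yes _ = irrefl G a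
... | no ¬p = ⊥-elim (¬p refl)

joinCopies : ∀ {n} (r : ℕ) → Graph n → Graph (r * n)
joinCopies {n} r G = record
  { adj    = λ k l → jadj G (remQuot {r} n k) (remQuot n l)
  ; sym    = λ k l → jadj-sym G (remQuot {r} n k) (remQuot n l)
  ; irrefl = λ k → jadj-irrefl G (remQuot {r} n k) }

-- A dominating set of size one is a single vertex adjacent to all others
-- (a universal vertex), so whenever γ = 1 the dominion counts universal
-- vertices.  In the join, vertex a of copy i is adjacent to every vertex of
-- the other copies, so it is universal iff a is universal in G.  Hence the
-- join of r ≥ 1 copies again has a universal vertex, so its domination
-- number is 1, and it has exactly r times as many universal vertices as G.
{-# OPTIONS --safe #-}
module Submission where

open import Defs hiding (sym)
open import Data.Bool using (Bool; true; false; T; _∧_; if_then_else_)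
open import Data.Bool.Properties using (T-≡; T-∧; T-∨; ∧-zeroʳ)
open import Data.Empty using (⊥-elim)
open import Data.Fin using (Fin; zero; suc; _↑ˡ_; _↑ʳ_; remQuot; combine; _≟_)
open import Data.Fin.Properties using (splitAt-↑ʳ; remQuot-combine; *↔×)
open import Data.Fin.Subset using (Subset; ∣_∣; _∈_; inside; outside; ⁅_⁆; ⊥; ⊤)
open import Data.Fin.Subset.Properties
  using (x∈⁅x⁆; x∈⁅y⁆⇒x≡y; ∣⁅x⁆∣≡1; ∈⊤; ∣⊤∣≡n; p⊆q⇒∣p∣≤∣q∣)
open import Data.List using (List; []; _∷_; map; _++_; filter; length; foldr)
open import Data.List.Properties using (foldr-map; foldr-preservesᵒ)
open import Data.List.Membership.Propositional using () renaming (_∈_ to _∈ᴸ_)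
open import Data.List.Membership.Propositional.Properties
  using (∈-filter⁺; ∈-filter⁻; ∈-map⁺; ∈-map⁻; ∈-++⁺ˡ; ∈-++⁺ʳ; foldr-selective)
import Data.List.Relation.Unary.Any as Any
open import Data.Nat using (ℕ; _+_; _*_; _≤_; _≥_; _⊓_)
import Data.Nat as ℕ
open import Data.Nat.Properties
  using (+-assoc; +-identityʳ; ⊓-sel; m≤n⇒m⊓o≤n; m≤n⇒o⊓m≤n; ≤-reflexive; ≤-antisym)
open import Data.Product using (_×_; _,_; proj₁; proj₂; ∃; map₁)
open import Data.Sum using (_⊎_; inj₁; inj₂; [_,_])
import Data.Sum as Sum
open import Data.Unit using (tt)
open import Data.Vec.Properties using (lookup⇒[]=; []=⇒lookup)
open import Data.Vec using ([]; _∷_; lookup)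
open import Function using (_∘_; id; _⇔_; mk⇔; Inverse; _↔_; Injection)
open import Function.Properties.Inverse using (↔⇒↣)
open import Function.Bundles using (module Equivalence)
open import Function.Construct.Composition using (_⇔-∘_)
open import Function.Construct.Symmetry using (⇔-sym)
open import Relation.Binary.PropositionalEquality
  using (_≡_; refl; sym; trans; cong; cong₂; subst; _≗_; module ≡-Reasoning)
open import Relation.Nullary using (does; yes; no; contradiction)
open import Relation.Unary using (Decidable)
import Data.Bool as Bool

open Equivalence using (to; from)

private variable
  A B : Set
  n : ℕ

T-injective : ∀ {a b} → T a ⇔ T b → a ≡ b
T-injective {true}  {true}  _ = refl
T-injective {false} {false} _ = refl
T-injective {true}  {false} a⇔b = ⊥-elim (to a⇔b tt)
T-injective {false} {true}  a⇔b = ⊥-elim (from a⇔b tt)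

does-≟-true : ∀ b → does (b Bool.≟ true) ≡ b
does-≟-true true  = refl
does-≟-true false = refl

T-allFin : {f : Fin n → Bool} → T (allFin f) ⇔ (∀ i → T (f i))
T-allFin {0}       = mk⇔ (λ _ ()) (λ _ → tt)
T-allFin {ℕ.suc n} = mk⇔
  (λ t → let t₀ , tₛ = to T-∧ t in λ { zero → t₀ ; (suc i) → to T-allFin tₛ i })
  (λ h → from T-∧ (h zero , from T-allFin (h ∘ suc)))

T-anyFin : {f : Fin n → Bool} → T (anyFin f) ⇔ ∃ λ i → T (f i)
T-anyFin {0}       = mk⇔ (λ ()) (λ ())
T-anyFin {ℕ.suc n} {f} = mk⇔ (Sum.[ (zero ,_) , shift ]′ ∘ to T-∨) λ where
    (zero  , t) → from T-∨ (inj₁ t)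
    (suc i , t) → from T-∨ (inj₂ (from T-anyFin (i , t)))
  where
  shift : T (anyFin (f ∘ suc)) → ∃ λ i → T (f i)
  shift t = let i , tᵢ = to T-anyFin t in suc i , tᵢ

T-mem : (i : Fin n) (S : Subset n) → T (mem i S) ⇔ i ∈ S
T-mem i S with lookup S i in eq
... | inside  = mk⇔ (λ _ → lookup⇒[]= i S eq) (λ _ → tt)
... | outside = mk⇔ (λ ()) (λ i∈S → contradiction (trans (sym ([]=⇒lookup i∈S)) eq) λ ())

Dominating : Graph n → Subset n → Set
Dominating H S = ∀ v → v ∈ S ⊎ ∃ λ u → u ∈ S × T (adj H u v)

Universal : (A → A → Bool) → A → Set
Universal R v = ∀ w → w ≡ v ⊎ T (R v w)

T-isDominating : (H : Graph n) (S : Subset n) → T (isDominating H S) ⇔ Dominating H S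
T-isDominating H S = mk⇔
  (λ d v → Sum.map (to (T-mem v S)) witness (to T-∨ (to T-allFin d v)))
  (λ d → from T-allFin λ v → from T-∨ (Sum.map (from (T-mem v S)) unwitness (d v)))
  where
  witness : ∀ {v} → T (anyFin (λ u → mem u S ∧ adj H u v)) →
            ∃ λ u → u ∈ S × T (adj H u v)
  witness t = let u , tᵤ = to T-anyFin t ; u∈S , a = to T-∧ tᵤ in u , to (T-mem u S) u∈S , a
  unwitness : ∀ {v} → (∃ λ u → u ∈ S × T (adj H u v)) →
              T (anyFin (λ u → mem u S ∧ adj H u v))
  unwitness (u , u∈S , a) = from T-anyFin (u , from T-∧ (from (T-mem u S) u∈S , a))

dominating-⁅⁆ : (H : Graph n) (v : Fin n) → Dominating H ⁅ v ⁆ ⇔ Universal (adj H) v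
dominating-⁅⁆ H v = mk⇔
  (λ d w → Sum.map (x∈⁅y⁆⇒x≡y v) from-v (d w))
  (λ u w → Sum.map (λ { refl → x∈⁅x⁆ v }) (λ a → v , x∈⁅x⁆ v , a) (u w))
  where
  from-v : ∀ {w} → (∃ λ u → u ∈ ⁅ v ⁆ × T (adj H u w)) → T (adj H v w)
  from-v {w} (u , u∈⁅v⁆ , a) = subst (λ u → T (adj H u w)) (x∈⁅y⁆⇒x≡y v u∈⁅v⁆) a

T-isDominating-⁅⁆ : (H : Graph n) (v : Fin n) → T (isDominating H ⁅ v ⁆) ⇔ Universal (adj H) v
T-isDominating-⁅⁆ H v = dominating-⁅⁆ H v ⇔-∘ T-isDominating H ⁅ v ⁆

x∈p⇒1≤∣p∣ : ∀ {x : Fin n} {p} → x ∈ p → 1 ≤ ∣ p ∣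
x∈p⇒1≤∣p∣ {x = x} {p} x∈p = subst (_≤ ∣ p ∣) (∣⁅x⁆∣≡1 x)
  (p⊆q⇒∣p∣≤∣q∣ λ y∈⁅x⁆ → subst (_∈ p) (sym (x∈⁅y⁆⇒x≡y x y∈⁅x⁆)) x∈p)

∣p∣≡0⇒p≡⊥ : ∀ {p : Subset n} → ∣ p ∣ ≡ 0 → p ≡ ⊥
∣p∣≡0⇒p≡⊥ {p = []}          _  = refl
∣p∣≡0⇒p≡⊥ {p = inside  ∷ p} ()
∣p∣≡0⇒p≡⊥ {p = outside ∷ p} eq = cong (outside ∷_) (∣p∣≡0⇒p≡⊥ eq)

∣p∣≡1⇒p≡⁅x⁆ : ∀ {p : Subset n} → ∣ p ∣ ≡ 1 → ∃ λ x → p ≡ ⁅ x ⁆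
∣p∣≡1⇒p≡⁅x⁆ {p = inside ∷ p}  eq = zero , cong (inside ∷_) (∣p∣≡0⇒p≡⊥ (cong ℕ.pred eq))
∣p∣≡1⇒p≡⁅x⁆ {p = outside ∷ p} eq =
  let x , p≡⁅x⁆ = ∣p∣≡1⇒p≡⁅x⁆ eq in suc x , cong (outside ∷_) p≡⁅x⁆

∈-allSubsets : ∀ m (S : Subset m) → S ∈ᴸ allSubsets m
∈-allSubsets 0         []            = Any.here refl
∈-allSubsets (ℕ.suc m) (inside  ∷ S) = ∈-++⁺ˡ (∈-map⁺ (inside ∷_) (∈-allSubsets m S))
∈-allSubsets (ℕ.suc m) (outside ∷ S) = ∈-++⁺ʳ _ (∈-map⁺ (outside ∷_) (∈-allSubsets m S))

module _ {n} (H : Graph n) where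

  ∈-dominatingSets : ∀ {S} → S ∈ᴸ dominatingSets H ⇔ Dominating H S
  ∈-dominatingSets {S} = mk⇔
    (λ S∈ → to (T-isDominating H S)
               (from T-≡ (proj₂ (∈-filter⁻ dominating? {xs = allSubsets n} S∈))))
    (λ d → ∈-filter⁺ dominating? (∈-allSubsets n S) (to T-≡ (from (T-isDominating H S) d)))
    where
    dominating? : Decidable (λ S → isDominating H S ≡ true)
    dominating? S = isDominating H S Bool.≟ true

  γ≡foldr-⊓ : γ H ≡ foldr _⊓_ n (map ∣_∣ (dominatingSets H))
  γ≡foldr-⊓ = sym (foldr-map _⊓_ ∣_∣ n (dominatingSets H))

  γ≤∣S∣ : ∀ {S} → Dominating H S → γ H ≤ ∣ S ∣
  γ≤∣S∣ {S} d = subst (_≤ ∣ S ∣) (sym γ≡foldr-⊓)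
    (foldr-preservesᵒ (λ x y → [ m≤n⇒m⊓o≤n y , m≤n⇒o⊓m≤n x ]) n _
      (inj₂ (Any.map (≤-reflexive ∘ sym) (∈-map⁺ ∣_∣ (from ∈-dominatingSets d)))))

  γ-attained : ∃ λ S → Dominating H S × ∣ S ∣ ≡ γ H
  γ-attained with foldr-selective ⊓-sel n (map ∣_∣ (dominatingSets H))
  ... | inj₁ min≡n  = ⊤ , (λ _ → inj₁ ∈⊤) , trans (∣⊤∣≡n n) (sym (trans γ≡foldr-⊓ min≡n))
  ... | inj₂ min∈ with ∈-map⁻ ∣_∣ min∈
  ... | S , S∈ , min≡∣S∣ = S , to ∈-dominatingSets S∈ , sym (trans γ≡foldr-⊓ min≡∣S∣)

  1≤γ : Fin n → 1 ≤ γ H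
  1≤γ v with γ-attained
  ... | S , d , ∣S∣≡γ =
    subst (1 ≤_) ∣S∣≡γ ([ x∈p⇒1≤∣p∣ , x∈p⇒1≤∣p∣ ∘ proj₁ ∘ proj₂ ] (d v))

  universal⇒γ≡1 : ∀ {v} → Universal (adj H) v → γ H ≡ 1
  universal⇒γ≡1 {v} u = ≤-antisym
    (subst (γ H ≤_) (∣⁅x⁆∣≡1 v) (γ≤∣S∣ (from (dominating-⁅⁆ H v) u)))
    (1≤γ v)

  γ≡1⇒universal : γ H ≡ 1 → ∃ (Universal (adj H))
  γ≡1⇒universal γ≡1 with γ-attained
  ... | S , d , ∣S∣≡γ with ∣p∣≡1⇒p≡⁅x⁆ {p = S} (trans ∣S∣≡γ γ≡1)
  ... | v , refl = v , to (dominating-⁅⁆ H v) d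

𝟙 : Bool → ℕ
𝟙 b = if b then 1 else 0

count : (A → Bool) → List A → ℕ
count p []       = 0
count p (x ∷ xs) = 𝟙 (p x) + count p xs

count-cong : {p q : A → Bool} → p ≗ q → ∀ xs → count p xs ≡ count q xs
count-cong p≗q []       = refl
count-cong p≗q (x ∷ xs) = cong₂ _+_ (cong 𝟙 (p≗q x)) (count-cong p≗q xs)

count-++ : (p : A → Bool) (xs ys : List A) → count p (xs ++ ys) ≡ count p xs + count p ys
count-++ p []       ys = refl
count-++ p (x ∷ xs) ys = trans (cong (𝟙 (p x) +_) (count-++ p xs ys)) (sym (+-assoc (𝟙 (p x)) _ _))

count-map : (p : B → Bool) (f : A → B) (xs : List A) → count p (map f xs) ≡ count (p ∘ f) xs
count-map p f []       = refl
count-map p f (x ∷ xs) = cong (𝟙 (p (f x)) +_) (count-map p f xs)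

count-false : (xs : List A) → count (λ _ → false) xs ≡ 0
count-false []       = refl
count-false (x ∷ xs) = count-false xs

length-filter-filter : ∀ {P Q : A → Set} (P? : Decidable P) (Q? : Decidable Q) xs →
  length (filter P? (filter Q? xs)) ≡ count (λ x → does (P? x) ∧ does (Q? x)) xs
length-filter-filter P? Q? []       = refl
length-filter-filter P? Q? (x ∷ xs) with does (Q? x)
... | false rewrite ∧-zeroʳ (does (P? x)) = length-filter-filter P? Q? xs
... | true with does (P? x)
...   | true  = cong ℕ.suc (length-filter-filter P? Q? xs)
...   | false = length-filter-filter P? Q? xs

countFin : (Fin n → Bool) → ℕ
countFin {0}       p = 0
countFin {ℕ.suc n} p = 𝟙 (p zero) + countFin (p ∘ suc)

countFin-cong : {p q : Fin n → Bool} → p ≗ q → countFin p ≡ countFin q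
countFin-cong {0}       p≗q = refl
countFin-cong {ℕ.suc n} p≗q = cong₂ _+_ (cong 𝟙 (p≗q zero)) (countFin-cong (p≗q ∘ suc))

countFin-+ : ∀ m {n} (p : Fin (m + n) → Bool) →
  countFin p ≡ countFin (p ∘ (_↑ˡ n)) + countFin (p ∘ (m ↑ʳ_))
countFin-+ 0         p = refl
countFin-+ (ℕ.suc m) p =
  trans (cong (𝟙 (p zero) +_) (countFin-+ m (p ∘ suc))) (sym (+-assoc (𝟙 (p zero)) _ _))

remQuot-↑ʳ : ∀ {r} n (k : Fin (r * n)) →
  remQuot {ℕ.suc r} n (n ↑ʳ k) ≡ map₁ suc (remQuot {r} n k)
remQuot-↑ʳ {r} n k rewrite splitAt-↑ʳ n (r * n) k = refl

countFin-remQuot : ∀ r {n} (p : Fin n → Bool) →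
  countFin (p ∘ proj₂ ∘ remQuot {r} n) ≡ r * countFin p
countFin-remQuot 0         p = refl
countFin-remQuot (ℕ.suc r) {n} p = begin
  countFin (p ∘ proj₂ ∘ remQuot {ℕ.suc r} n)
    ≡⟨ countFin-+ n (p ∘ proj₂ ∘ remQuot {ℕ.suc r} n) ⟩
  countFin (λ a → p (proj₂ (remQuot {ℕ.suc r} n (a ↑ˡ r * n))))
    + countFin (λ k → p (proj₂ (remQuot {ℕ.suc r} n (n ↑ʳ k))))
    ≡⟨ cong₂ _+_ (countFin-cong (cong (p ∘ proj₂) ∘ remQuot-combine {ℕ.suc r} {n} zero))
                 (countFin-cong (cong (p ∘ proj₂) ∘ remQuot-↑ʳ {r} n)) ⟩
  countFin p + countFin (p ∘ proj₂ ∘ remQuot {r} n)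
    ≡⟨ cong (countFin p +_) (countFin-remQuot r p) ⟩
  countFin p + r * countFin p
    ∎
  where open ≡-Reasoning

count-allSubsets : ∀ m (p : Subset (ℕ.suc m) → Bool) →
  count p (allSubsets (ℕ.suc m))
    ≡ count (p ∘ (inside ∷_)) (allSubsets m) + count (p ∘ (outside ∷_)) (allSubsets m)
count-allSubsets m p = begin
  count p (map (inside ∷_) subsets ++ map (outside ∷_) subsets)
    ≡⟨ count-++ p (map (inside ∷_) subsets) _ ⟩
  count p (map (inside ∷_) subsets) + count p (map (outside ∷_) subsets)
    ≡⟨ cong₂ _+_ (count-map p (inside ∷_) subsets) (count-map p (outside ∷_) subsets) ⟩
  count (p ∘ (inside ∷_)) subsets + count (p ∘ (outside ∷_)) subsets
    ∎
  where
  open ≡-Reasoning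
  subsets : List (Subset m)
  subsets = allSubsets m

count-∣S∣≡0 : ∀ m (q : Subset m → Bool) →
  count (λ S → does (∣ S ∣ ℕ.≟ 0) ∧ q S) (allSubsets m) ≡ 𝟙 (q ⊥)
count-∣S∣≡0 0         q = +-identityʳ (𝟙 (q []))
count-∣S∣≡0 (ℕ.suc m) q = trans (count-allSubsets m _)
  (cong₂ _+_ (count-false (allSubsets m)) (count-∣S∣≡0 m (q ∘ (outside ∷_))))

count-∣S∣≡1 : ∀ m (q : Subset m → Bool) →
  count (λ S → does (∣ S ∣ ℕ.≟ 1) ∧ q S) (allSubsets m) ≡ countFin (q ∘ ⁅_⁆)
count-∣S∣≡1 0         q = refl
count-∣S∣≡1 (ℕ.suc m) q = trans (count-allSubsets m _)
  (cong₂ _+_ (count-∣S∣≡0 m (q ∘ (inside ∷_))) (count-∣S∣≡1 m (q ∘ (outside ∷_))))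

ζ≡countFin : (H : Graph n) → γ H ≡ 1 → ζ H ≡ countFin (λ v → isDominating H ⁅ v ⁆)
ζ≡countFin {n} H γ≡1 = begin
  ζ H
    ≡⟨ length-filter-filter (λ S → ∣ S ∣ ℕ.≟ γ H) (λ S → isDominating H S Bool.≟ true) subsets ⟩
  count (λ S → does (∣ S ∣ ℕ.≟ γ H) ∧ does (isDominating H S Bool.≟ true)) subsets
    ≡⟨ count-cong (λ S → cong₂ _∧_ (cong (does ∘ (∣ S ∣ ℕ.≟_)) γ≡1) (does-≟-true (isDominating H S)))
                  subsets ⟩
  count (λ S → does (∣ S ∣ ℕ.≟ 1) ∧ isDominating H S) subsets
    ≡⟨ count-∣S∣≡1 n (isDominating H) ⟩
  countFin (λ v → isDominating H ⁅ v ⁆)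
    ∎
  where
  open ≡-Reasoning
  subsets : List (Subset n)
  subsets = allSubsets n

universal-↔ : (f : A ↔ B) (R : B → B → Bool) {x : A} →
  Universal (λ y z → R (Inverse.to f y) (Inverse.to f z)) x ⇔ Universal R (Inverse.to f x)
universal-↔ f R {x} = mk⇔
  (λ u w → Sum.map (λ f⁻¹w≡x → trans (sym (F.strictlyInverseˡ w)) (cong F.to f⁻¹w≡x))
                   (subst (T ∘ R (F.to x)) (F.strictlyInverseˡ w))
                   (u (F.from w)))
  (λ u y → Sum.map (Injection.injective (↔⇒↣ f)) id (u (F.to y)))
  where module F = Inverse f

universal-jadj : ∀ {r} (G : Graph n) {i : Fin r} {a : Fin n} →
  Universal (jadj G) (i , a) ⇔ Universal (adj G) a
universal-jadj G {i} {a} = mk⇔ to′ from′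
  where
  to′ : Universal (jadj G) (i , a) → Universal (adj G) a
  to′ u b with i ≟ i | u (i , b)
  ... | yes _   | inj₁ refl = inj₁ refl
  ... | yes _   | inj₂ a~b  = inj₂ a~b
  ... | no i≢i  | _         = contradiction refl i≢i
  from′ : Universal (adj G) a → Universal (jadj G) (i , a)
  from′ u (j , b) with i ≟ j
  ... | no _     = inj₂ tt
  ... | yes refl = Sum.map (cong (i ,_)) id (u b)

-- adj (joinCopies r G) is definitionally jadj G pulled back along remQuot,
-- the forward map of *↔×.
universal-join : ∀ r (G : Graph n) (k : Fin (r * n)) →
  Universal (adj (joinCopies r G)) k ⇔ Universal (adj G) (proj₂ (remQuot {r} n k))
universal-join r G k = universal-jadj G ⇔-∘ universal-↔ *↔× (jadj G)

isDominating-⁅⁆-join : ∀ r (G : Graph n) (k : Fin (r * n)) →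
  isDominating (joinCopies r G) ⁅ k ⁆ ≡ isDominating G ⁅ proj₂ (remQuot {r} n k) ⁆
isDominating-⁅⁆-join r G k = T-injective
  (⇔-sym (T-isDominating-⁅⁆ G _) ⇔-∘
   (universal-join r G k ⇔-∘ T-isDominating-⁅⁆ (joinCopies r G) k))

γ-joinCopies : ∀ r (G : Graph n) → γ G ≡ 1 → γ (joinCopies (ℕ.suc r) G) ≡ 1
γ-joinCopies {n} r G γ≡1 with γ≡1⇒universal G γ≡1
... | a , a-universal = universal⇒γ≡1 (joinCopies (ℕ.suc r) G)
  (from (universal-join (ℕ.suc r) G (combine {ℕ.suc r} zero a))
        (subst (Universal (adj G) ∘ proj₂) (sym (remQuot-combine {ℕ.suc r} {n} zero a)) a-universal))

corollary3p4 : ∀ {n : ℕ} (G : Graph n) → Connected G → γ G ≡ 1 →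
    (r : ℕ) → r ≥ 1 → ζ (joinCopies r G) ≡ r * ζ G
corollary3p4 {n} G _ γG≡1 r@(ℕ.suc r′) _ = begin
  ζ J
    ≡⟨ ζ≡countFin J (γ-joinCopies r′ G γG≡1) ⟩
  countFin (λ k → isDominating J ⁅ k ⁆)
    ≡⟨ countFin-cong (isDominating-⁅⁆-join r G) ⟩
  countFin (λ k → isDominating G ⁅ proj₂ (remQuot {r} n k) ⁆)
    ≡⟨ countFin-remQuot r (λ a → isDominating G ⁅ a ⁆) ⟩
  r * countFin (λ a → isDominating G ⁅ a ⁆)
    ≡⟨ cong (r *_) (ζ≡countFin G γG≡1) ⟨
  r * ζ G
    ∎
  where
  open ≡-Reasoning
  J : Graph (r * n)
  J = joinCopies r G
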